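{- For all integers $r\ge 2$, $f_{2,r}=f_{((1,0,\dots,0),1)}=\frac{r+1}{2r}$.
   Context: A $k$-graph $H$ has vertex set $V(H)$ and edges which are $k$-subsets of $V(H)$; $\delta_1(H)$ is its minimum vertex degree. Given a partition $\{V_1,\dots,V_r\}$ of $V(H)$, an edge $e$ has type $(t_1,\dots,t_r)$ if $|e\cap V_i|=t_i$ for all $i$; $\mathbf e_i$ is the $i$th standard unit vector of $\mathbb Z^r$. For $k,r\ge2$, $(\mathbf j,\sigma)$ with $\mathbf j\in\mathbb N_0^r$, $\sigma\in\{ -1,1\}$ is $k$-valid if $\sigma+\sum_i j_i=k$ and $j_i+\sigma\ge0$ for all $i$. An $r$-edge-coloured $k$-graph $H$ is in $\mathcal F_{k,r}(\mathbf j,\sigma)$ if $n=|V(H)|$ is divisible by $kr$ and there is a partition $\{V_1,\dots,V_r\}$ of $V(H)$ with $|V_i|=\frac{rj_i+\sigma}{rk}n$ for all $i$ such that for each $i\in[r]$ every edge of colour $i$ has type $\mathbf j+\sigma\mathbf e_i$. Define \[f_{(\mathbf j,\sigma)}:=\lim_{n\to\infty}\max_{H\in\mathcal F_{k,r}(\mathbf j,\sigma),\,|V(H)|=krn}\frac{\delta_1(H)}{\binom{|V(H)|-1}{k-1}},\] and $f_{k,r}:=\max f_{(\mathbf j,\sigma)}$ over all $k$-valid pairs $(\mathbf j,\sigma)$ with $\mathbf j\in\mathbb N_0^r$ (equivalently, the analogous limit with the maximum over the union $\mathcal F_{k,r}$ of all these families). Here $k=2$, and $(1,0,\dots,0)\in\mathbb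 N_0^r$. -}

module Defs where

open import Data.Nat as ℕ using (ℕ; zero; suc; _⊓_)
open import Data.Nat.Combinatorics using (_C_)
open import Data.Integer as ℤ using (ℤ; +_)
open import Data.Rational as ℚ using (ℚ; 0ℚ; Positive)
open import Data.Fin using (Fin; toℕ)
open import Data.Fin.Properties using () renaming (_≟_ to _≟ᶠ_)
open import Data.Bool using (Bool; true; false; if_then_else_)
open import Data.Maybe using (Maybe; just; nothing; is-just)
open import Data.List using (List; []; _∷_; foldr; map; allFin)
open import Data.Nat.ListAction using (sum)
open import Data.Product using (Σ; _×_; ∃)
open import Data.Sum using (_⊎_)
open import Relation.Nullary.Decidable using (⌊_⌋)
open import Relation.Binary.PropositionalEquality using (_≡_)

count : ∀ {N} → (Fin N → Bool) → ℕ
count {N} p = sum (map (λ u → if p u then 1 else 0) (allFin N))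

-- An r-edge-coloured 2-graph on vertex set Fin N:
-- c u v = nothing  : {u,v} is not an edge
-- c u v = just i   : {u,v} is an edge of colour i
Colouring : ℕ → ℕ → Set
Colouring r N = Fin N → Fin N → Maybe (Fin r)

IsColoured2Graph : ∀ {r N} → Colouring r N → Set
IsColoured2Graph {r} {N} c =
  ((u v : Fin N) → c u v ≡ c v u) × ((v : Fin N) → c v v ≡ nothing)

degree : ∀ {r N} → Colouring r N → Fin N → ℕ
degree c v = count (λ u → is-just (c v u))

minList : List ℕ → ℕ
minList [] = 0
minList (x ∷ xs) = foldr _⊓_ x xs

δ₁ : ∀ {r N} → Colouring r N → ℕ
δ₁ {r} {N} c = minList (map (degree c) (allFin N))

-- a / b as a rational (b = 0 never occurs for the graphs considered with n ≥ 1)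
divℕ : ℕ → ℕ → ℚ
divℕ a zero = 0ℚ
divℕ a (suc m) = (+ a) ℚ./ suc m

ratio : ∀ {r N} → Colouring r N → ℚ
ratio {r} {N} c = divℕ (δ₁ c) ((N ℕ.∸ 1) C 1)

sumFin : ∀ {r} → (Fin r → ℕ) → ℕ
sumFin {r} j = sum (map j (allFin r))

Valid2 : (r : ℕ) → (Fin r → ℕ) → ℤ → Set
Valid2 r j σ = (σ ≡ ℤ.+ 1 ⊎ σ ≡ ℤ.- (ℤ.+ 1))
  × (σ ℤ.+ + sumFin j ≡ + 2)
  × ((i : Fin r) → + 0 ℤ.≤ + j i ℤ.+ σ)

-- membership of the coloured 2-graph c on Fin (2 r n) in F_{2,r}(j,σ)
-- (|V(H)| = 2rn is automatically divisible by kr = 2r; part sizes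
--  (r j_i + σ)/(rk) · |V(H)| = (r j_i + σ) n)
InFamily : (r : ℕ) → (Fin r → ℕ) → ℤ → (n : ℕ) → Colouring r (2 ℕ.* r ℕ.* n) → Set
InFamily r j σ n c = Σ (Fin (2 ℕ.* r ℕ.* n) → Fin r) λ part →
    ((i : Fin r) → + count (λ v → ⌊ part v ≟ᶠ i ⌋) ≡ (+ (r ℕ.* j i) ℤ.+ σ) ℤ.* + n)
  × ((u v : Fin (2 ℕ.* r ℕ.* n)) (i : Fin r) → c u v ≡ just i →
       (m : Fin r) →
         + ((if ⌊ part u ≟ᶠ m ⌋ then 1 else 0) ℕ.+ (if ⌊ part v ≟ᶠ m ⌋ then 1 else 0))
           ≡ + j m ℤ.+ (if ⌊ m ≟ᶠ i ⌋ then σ else + 0))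

InUnion : (r : ℕ) → (n : ℕ) → Colouring r (2 ℕ.* r ℕ.* n) → Set
InUnion r n c = Σ (Fin r → ℕ) λ j → Σ ℤ λ σ → Valid2 r j σ × InFamily r j σ n c

IsMaxRatio : (r n : ℕ) → (Colouring r (2 ℕ.* r ℕ.* n) → Set) → ℚ → Set
IsMaxRatio r n P m =
    ((c : Colouring r (2 ℕ.* r ℕ.* n)) → IsColoured2Graph c → P c → ratio c ℚ.≤ m)
  × (Σ (Colouring r (2 ℕ.* r ℕ.* n)) λ c → IsColoured2Graph c × P c × ratio c ≡ m)

ConvergesTo : (ℕ → ℚ) → ℚ → Set
ConvergesTo a L = (ε : ℚ) → Positive ε → ∃ λ N₀ → (n : ℕ) → N₀ ℕ.≤ n → ℚ.∣ a n ℚ.- L ∣ ℚ.≤ ε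

LimMaxRatio : (r : ℕ) → ((n : ℕ) → Colouring r (2 ℕ.* r ℕ.* n) → Set) → ℚ → Set
LimMaxRatio r P L = Σ (ℕ → ℚ) λ a → ((n : ℕ) → IsMaxRatio r n (P n) (a n)) × ConvergesTo a L

e₁ : ∀ {r} → Fin r → ℕ
e₁ i with toℕ i
... | zero = 1
... | suc _ = 0

{-# OPTIONS --safe #-}

-- Parts and colours are indexed by Fin r, so e₁ puts its 1 on part 0.
--
-- Let H ∈ F(j, σ) have 2rn vertices and parts |Vᵢ| = (r jᵢ + σ) n.
-- If σ = 1 then Σ j = 1, so j = e_a and every edge has type e_a + eᵢ: a vertex
-- of another part V_b (there is one as r ≥ 2) has all its neighbours in V_a,
-- so δ₁ ≤ |V_a| = (r + 1) n.  If σ = -1 then Σ j = 3 < 2r and all jᵢ ≥ 1, so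
-- j_b = 1 for some b; a colour-i edge meets V_b in j_b - [b = i] ≤ 1 vertices,
-- so a vertex of V_b has degree at most 2rn - |V_b| = 2rn - (r - 1) n = (r + 1) n.
--
-- In F(e₁, 1) take |V₀| = (r + 1) n, |Vᵢ| = n, and let the edges be
-- exactly the pairs meeting V₀, an edge between V₀ and Vᵢ getting colour i.
-- Vertices of V₀ then have degree 2rn - 1 and all others (r + 1) n, so the
-- maximal ratio is (r + 1) n / (2rn - 1), which tends to (r + 1) / 2r.

module Submission where

open import Defs
open import Data.Nat using (ℕ; _≤_; _+_; _*_)
open import Data.Integer using (+_)
open import Data.Product using (_×_)

open import Data.Bool.Base using (Bool; true; false; not; T; if_then_else_)
open import Data.Fin.Base using (Fin; zero; suc; _↑ˡ_; _↑ʳ_; splitAt; quotient)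
open import Data.Fin.Properties using (_≟_; splitAt-↑ˡ; splitAt-↑ʳ; ¬∀⟶∃¬)
import Data.Integer.Base as ℤ
import Data.Integer.Properties as ℤ
open import Data.List.Base using (map; allFin; tabulate)
open import Data.List.Properties
  using (map-cong; map-tabulate; foldr-preservesᵇ; foldr-preservesᵒ)
open import Data.List.Relation.Unary.Any using (Any)
import Data.List.Relation.Unary.All.Properties as All
import Data.List.Relation.Unary.Any.Properties as Any
open import Data.Maybe.Base using (Maybe; just; nothing; is-just)
open import Data.Nat.Base using (zero; suc; _<_; _∸_; _⊓_; z≤n; s≤s)
open import Data.Nat.Combinatorics using (_C_; nC1≡n)
open import Data.Nat.ListAction using (sum)
open import Data.Nat.Properties hiding (_≟_)
open import Data.Nat.Solver using (module +-*-Solver)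
open import Data.Product using (∃; _,_; proj₁; proj₂)
import Data.Rational.Base as ℚ
import Data.Rational.Properties as ℚ
open import Data.Rational.Unnormalised.Base as ℚᵘ using (mkℚᵘ)
import Data.Rational.Unnormalised.Properties as ℚᵘ
open import Data.Sum.Base using (_⊎_; inj₁; inj₂; [_,_]′)
open import Function.Base using (_∘_; id; const; case_of_)
open import Function.Bundles using (mk⇔)
open import Relation.Binary.PropositionalEquality
open import Relation.Nullary.Decidable
  using (⌊_⌋; isYes≗does; does-⇔; ⌊⌋-map′; toWitness; toWitnessFalse; fromWitnessFalse)
open import Relation.Nullary.Negation using (¬_; contradiction)

open +-*-Solver

𝟙 : Bool → ℕ
𝟙 b = if b then 1 else 0

𝟙-true : ∀ {b} → T b → 𝟙 b ≡ 1
𝟙-true {true} _ = refl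

𝟙-false : ∀ {b} → T (not b) → 𝟙 b ≡ 0
𝟙-false {false} _ = refl

𝟙-pos : ∀ {b} → 0 < 𝟙 b → T b
𝟙-pos {true} _ = _

𝟙-zero : ∀ {b} → 𝟙 b ≤ 0 → T (not b)
𝟙-zero {false} _ = _

count-suc : ∀ {N} (p : Fin (suc N) → Bool) → count p ≡ 𝟙 (p zero) + count (p ∘ suc)
count-suc p = cong (λ xs → 𝟙 (p zero) + sum xs)
  (trans (map-tabulate suc (𝟙 ∘ p)) (sym (map-tabulate id (𝟙 ∘ p ∘ suc))))

count-cong : ∀ {N} {p q : Fin N → Bool} → (∀ u → p u ≡ q u) → count p ≡ count q
count-cong {N} p≗q = cong sum (map-cong (cong 𝟙 ∘ p≗q) (allFin N))

count-mono : ∀ {N} {p q : Fin N → Bool} → (∀ u → T (p u) → T (q u)) → count p ≤ count q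
count-mono {zero}  p⇒q = z≤n
count-mono {suc N} {p} {q} p⇒q rewrite count-suc p | count-suc q =
  +-mono-≤ (𝟙-mono (p zero) (q zero) (p⇒q zero)) (count-mono (p⇒q ∘ suc))
  where
  𝟙-mono : ∀ a b → (T a → T b) → 𝟙 a ≤ 𝟙 b
  𝟙-mono false b     _   = z≤n
  𝟙-mono true  true  _   = ≤-refl
  𝟙-mono true  false a⇒b = contradiction _ a⇒b

count-const : ∀ N b → count {N} (const b) ≡ N * 𝟙 b
count-const zero    b = refl
count-const (suc N) b = trans (count-suc {N} (const b)) (cong (λ m → 𝟙 b + m) (count-const N b))

count-complement : ∀ {N} (p : Fin N → Bool) → count p + count (not ∘ p) ≡ N
count-complement {zero}  p = refl
count-complement {suc N} p rewrite count-suc p | count-suc (not ∘ p) with p zero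
... | true  = cong suc (count-complement (p ∘ suc))
... | false = trans (+-suc (count (p ∘ suc)) _) (cong suc (count-complement (p ∘ suc)))

count-witness : ∀ {N} (p : Fin N → Bool) → 0 < count p → ∃ λ u → T (p u)
count-witness {suc N} p 0<count with subst (0 <_) (count-suc p) 0<count
... | 0<𝟙+count with p zero in p₀
...   | true  = zero , subst T (sym p₀) _
...   | false = let u , pu = count-witness (p ∘ suc) 0<𝟙+count in suc u , pu

≟-sym : ∀ {N} (u v : Fin N) → ⌊ u ≟ v ⌋ ≡ ⌊ v ≟ u ⌋
≟-sym u v = trans (isYes≗does (u ≟ v))
  (trans (does-⇔ (mk⇔ sym sym) (u ≟ v) (v ≟ u)) (sym (isYes≗does (v ≟ u))))

count-≟ : ∀ {N} (i : Fin N) → count (λ u → ⌊ u ≟ i ⌋) ≡ 1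
count-≟ {suc N} zero =
  trans (count-suc {N} (λ u → ⌊ u ≟ zero ⌋)) (cong suc (trans (count-const N false) (*-zeroʳ N)))
count-≟ {suc N} (suc i) = begin
  count (λ u → ⌊ u ≟ suc i ⌋)      ≡⟨ count-suc (λ u → ⌊ u ≟ suc i ⌋) ⟩
  count (λ u → ⌊ suc u ≟ suc i ⌋)  ≡⟨ count-cong (λ u → ⌊⌋-map′ _ _ (u ≟ i)) ⟩
  count (λ u → ⌊ u ≟ i ⌋)          ≡⟨ count-≟ i ⟩
  1                                ∎
  where open ≡-Reasoning

count-↑ : ∀ m {n} (p : Fin (m + n) → Bool) →
          count p ≡ count (p ∘ (_↑ˡ n)) + count (p ∘ (m ↑ʳ_))
count-↑ zero    p = refl
count-↑ (suc m) {n} p = begin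
  count p
    ≡⟨ count-suc p ⟩
  𝟙 (p zero) + count (p ∘ suc)
    ≡⟨ cong (_+_ (𝟙 (p zero))) (count-↑ m (p ∘ suc)) ⟩
  𝟙 (p zero) + (count (p ∘ suc ∘ (_↑ˡ n)) + count (p ∘ suc ∘ (m ↑ʳ_)))
    ≡⟨ +-assoc (𝟙 (p zero)) _ _ ⟨
  𝟙 (p zero) + count (p ∘ suc ∘ (_↑ˡ n)) + count (p ∘ (suc m ↑ʳ_))
    ≡⟨ cong (_+ count (p ∘ (suc m ↑ʳ_))) (count-suc (p ∘ (_↑ˡ n))) ⟨
  count (p ∘ (_↑ˡ n)) + count (p ∘ (suc m ↑ʳ_))
    ∎
  where open ≡-Reasoning

quotient-↑ˡ : ∀ {m} n (i : Fin n) → quotient {suc m} n (i ↑ˡ m * n) ≡ zero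
quotient-↑ˡ {m} n i rewrite splitAt-↑ˡ n i (m * n) = refl

quotient-↑ʳ : ∀ {m} n (j : Fin (m * n)) → quotient {suc m} n (n ↑ʳ j) ≡ suc (quotient n j)
quotient-↑ʳ {m} n j rewrite splitAt-↑ʳ n (m * n) j = refl

count-∘quotient : ∀ m n (p : Fin m → Bool) → count {m * n} (p ∘ quotient n) ≡ count p * n
count-∘quotient zero    n p = refl
count-∘quotient (suc m) n p = begin
  count (p ∘ quotient n)
    ≡⟨ count-↑ n (p ∘ quotient n) ⟩
  count (p ∘ quotient n ∘ (_↑ˡ m * n)) + count (p ∘ quotient n ∘ (n ↑ʳ_))
    ≡⟨ cong₂ _+_ (count-cong (cong p ∘ quotient-↑ˡ n)) (count-cong (cong p ∘ quotient-↑ʳ n)) ⟩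
  count {n} (const (p zero)) + count (λ j → p (suc (quotient n j)))
    ≡⟨ cong₂ _+_ (count-const n (p zero)) (count-∘quotient m n (p ∘ suc)) ⟩
  n * 𝟙 (p zero) + count (p ∘ suc) * n
    ≡⟨ cong (_+ count (p ∘ suc) * n) (*-comm n _) ⟩
  𝟙 (p zero) * n + count (p ∘ suc) * n
    ≡⟨ *-distribʳ-+ n (𝟙 (p zero)) _ ⟨
  (𝟙 (p zero) + count (p ∘ suc)) * n
    ≡⟨ cong (_* n) (count-suc p) ⟨
  count p * n
    ∎
  where open ≡-Reasoning

δ₁-empty : ∀ {r N} (c : Colouring r N) → N ≡ 0 → δ₁ c ≡ 0
δ₁-empty c refl = refl

δ₁≤degree : ∀ {r N} (c : Colouring r N) v → δ₁ c ≤ degree c v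
δ₁≤degree {N = suc N} c v = foldr-preservesᵒ {P = _≤ degree c v} ⊓-≤ (degree c zero) _ (at v)
  where
  ⊓-≤ : ∀ x y → x ≤ degree c v ⊎ y ≤ degree c v → x ⊓ y ≤ degree c v
  ⊓-≤ x y = [ m≤n⇒m⊓o≤n y , m≤n⇒o⊓m≤n x ]′
  at : ∀ u → degree c zero ≤ degree c u ⊎ Any (_≤ degree c u) (map (degree c) (tabulate suc))
  at zero    = inj₁ ≤-refl
  at (suc u) = inj₂ (Any.map⁺ (Any.tabulate⁺ u ≤-refl))

≤δ₁ : ∀ {r N} (c : Colouring r N) {L} → 0 < N → (∀ v → L ≤ degree c v) → L ≤ δ₁ c
≤δ₁ {N = suc N} c {L} _ L≤degree =
  foldr-preservesᵇ {P = L ≤_} ⊓-glb (L≤degree zero) (All.map⁺ (All.tabulate⁺ (L≤degree ∘ suc)))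

degree≤count : ∀ {r N} (c : Colouring r N) v {q : Fin N → Bool} →
               (∀ u i → c v u ≡ just i → T (q u)) → degree c v ≤ count q
degree≤count c v {q} edge⇒q = count-mono neighbour⇒q
  where
  neighbour⇒q : ∀ u → T (is-just (c v u)) → T (q u)
  neighbour⇒q u with c v u in cvu
  ... | just i = λ _ → edge⇒q u i cvu

sumFin-suc : ∀ {r} (j : Fin (suc r) → ℕ) → sumFin j ≡ j zero + sumFin (j ∘ suc)
sumFin-suc j = cong (λ xs → j zero + sum xs)
  (trans (map-tabulate suc j) (sym (map-tabulate id (j ∘ suc))))

sumFin-const : ∀ r k → sumFin {r} (const k) ≡ r * k
sumFin-const zero    k = refl
sumFin-const (suc r) k = trans (sumFin-suc {r} (const k)) (cong (_+_ k) (sumFin-const r k))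

sumFin-mono : ∀ {r} {j j′ : Fin r → ℕ} → (∀ i → j i ≤ j′ i) → sumFin j ≤ sumFin j′
sumFin-mono {zero}  j≤j′ = z≤n
sumFin-mono {suc r} {j} {j′} j≤j′ rewrite sumFin-suc j | sumFin-suc j′ =
  +-mono-≤ (j≤j′ zero) (sumFin-mono (j≤j′ ∘ suc))

≤sumFin : ∀ {r} (j : Fin r → ℕ) i → j i ≤ sumFin j
≤sumFin j zero    rewrite sumFin-suc j = m≤m+n (j zero) _
≤sumFin j (suc i) rewrite sumFin-suc j = ≤-trans (≤sumFin (j ∘ suc) i) (m≤n+m _ (j zero))

sumFin<⇒∃≤ : ∀ {r} (j : Fin r → ℕ) k → sumFin j < r * suc k → ∃ λ i → j i ≤ k
sumFin<⇒∃≤ {r} j k sum<r[1+k] =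
  let i , k≮ji = ¬∀⟶∃¬ r (λ i → k < j i) (λ i → k <? j i) ¬∀k< in i , ≮⇒≥ k≮ji
  where
  ¬∀k< : ¬ (∀ i → k < j i)
  ¬∀k< ∀k< = <⇒≱ sum<r[1+k] (≤-trans (≤-reflexive (sym (sumFin-const r (suc k)))) (sumFin-mono ∀k<))

sumFin>⇒∃> : ∀ {r} (j : Fin r → ℕ) k → r * k < sumFin j → ∃ λ i → k < j i
sumFin>⇒∃> {r} j k r*k<sum =
  let i , ji≰k = ¬∀⟶∃¬ r (λ i → j i ≤ k) (λ i → j i ≤? k) ¬∀≤k in i , ≰⇒> ji≰k
  where
  ¬∀≤k : ¬ (∀ i → j i ≤ k)
  ¬∀≤k ∀≤k = <⇒≱ r*k<sum (≤-trans (sumFin-mono ∀≤k) (≤-reflexive (sumFin-const r k)))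

sumFin≡1⇒∃≡1 : ∀ {r} (j : Fin r → ℕ) → sumFin j ≡ 1 → ∃ λ a → j a ≡ 1
sumFin≡1⇒∃≡1 {r} j Σj≡1 =
  let a , 0<ja = sumFin>⇒∃> j 0 (subst₂ _<_ (sym (*-zeroʳ r)) (sym Σj≡1) (s≤s z≤n))
  in  a , ≤-antisym (subst (j a ≤_) Σj≡1 (≤sumFin j a)) 0<ja

sumFin≡3⇒∃≡1 : ∀ {r} (j : Fin r → ℕ) → 2 ≤ r → sumFin j ≡ 3 → (∀ i → 1 ≤ j i) →
               ∃ λ b → j b ≡ 1
sumFin≡3⇒∃≡1 {r} j 2≤r Σj≡3 1≤j =
  let b , jb≤1 = sumFin<⇒∃≤ j 1 (subst (_< r * 2) (sym Σj≡3) (*-monoˡ-≤ 2 2≤r))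
  in  b , ≤-antisym jb≤1 (1≤j b)

∃-≢ : ∀ {r} → 2 ≤ r → (a : Fin r) → ∃ λ b → a ≢ b
∃-≢ (s≤s (s≤s _)) zero    = suc zero , λ ()
∃-≢ (s≤s (s≤s _)) (suc a) = zero , λ ()

+-injective-* : ∀ {x} y n → + x ≡ + y ℤ.* + n → x ≡ y * n
+-injective-* y n x≡y*n = ℤ.+-injective (trans x≡y*n (sym (ℤ.pos-* y n)))

-- The edge condition |e ∩ Vₘ| = jₘ + σ [m = i] of InFamily, read for σ = 1 and σ = -1.
type⁺⇒≤ : ∀ {x y} t → + x ≡ + y ℤ.+ (if t then + 1 else + 0) → y ≤ x
type⁺⇒≤ {y = y} true  x≡y+1 = ≤-trans (m≤m+n y 1) (≤-reflexive (sym (ℤ.+-injective x≡y+1)))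
type⁺⇒≤ {y = y} false x≡y+0 = ≤-trans (m≤m+n y 0) (≤-reflexive (sym (ℤ.+-injective x≡y+0)))

type⁻⇒≤ : ∀ {x y} t → + x ≡ + y ℤ.+ (if t then ℤ.-[1+ 0 ] else + 0) → x ≤ y
type⁻⇒≤ {y = zero}  true  ()
type⁻⇒≤ {y = suc y} true  x≡y   = ≤-trans (≤-reflexive (ℤ.+-injective x≡y)) (n≤1+n y)
type⁻⇒≤ {y = y}     false x≡y+0 = ≤-reflexive (trans (ℤ.+-injective x≡y+0) (+-identityʳ y))

inPart : ∀ {r N} → (Fin N → Fin r) → Fin r → Fin N → Bool
inPart part i v = ⌊ part v ≟ i ⌋

δ₁≤-σ⁺ : ∀ {r n j c} → 2 ≤ r → 0 < n → sumFin j ≡ 1 → InFamily r j (+ 1) n c →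
         δ₁ c ≤ (r + 1) * n
δ₁≤-σ⁺ {r} {n} {j} {c} 2≤r 0<n Σj≡1 (part , sizes , types) = begin
  δ₁ c                   ≤⟨ δ₁≤degree c v ⟩
  degree c v             ≤⟨ degree≤count c v neighbour∈Vₐ ⟩
  count (inPart part a)  ≡⟨ |V| a ⟩
  (r * j a + 1) * n      ≡⟨ cong (λ x → (r * x + 1) * n) ja≡1 ⟩
  (r * 1 + 1) * n        ≡⟨ cong (λ x → (x + 1) * n) (*-identityʳ r) ⟩
  (r + 1) * n            ∎
  where
  open ≤-Reasoning
  |V| : ∀ i → count (inPart part i) ≡ (r * j i + 1) * n
  |V| i = +-injective-* (r * j i + 1) n (sizes i)
  a = proj₁ (sumFin≡1⇒∃≡1 j Σj≡1)
  ja≡1 = proj₂ (sumFin≡1⇒∃≡1 j Σj≡1)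
  b = proj₁ (∃-≢ 2≤r a)
  a≢b = proj₂ (∃-≢ 2≤r a)
  n≤|Vb| : n ≤ count (inPart part b)
  n≤|Vb| = begin
    n                      ≡⟨ *-identityˡ n ⟨
    1 * n                  ≤⟨ *-monoˡ-≤ n (m≤n+m 1 (r * j b)) ⟩
    (r * j b + 1) * n      ≡⟨ |V| b ⟨
    count (inPart part b)  ∎
  v = proj₁ (count-witness (inPart part b) (≤-trans 0<n n≤|Vb|))
  v∈Vb = proj₂ (count-witness (inPart part b) (≤-trans 0<n n≤|Vb|))
  neighbour∈Vₐ : ∀ u i → c v u ≡ just i → T (inPart part a u)
  neighbour∈Vₐ u i cvu≡i = 𝟙-pos (begin
    1
      ≡⟨ ja≡1 ⟨
    j a
      ≤⟨ type⁺⇒≤ ⌊ a ≟ i ⌋ (types v u i cvu≡i a) ⟩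
    𝟙 (inPart part a v) + 𝟙 (inPart part a u)
      ≡⟨ cong (_+ 𝟙 (inPart part a u)) (𝟙-false (fromWitnessFalse v∉Vₐ)) ⟩
    𝟙 (inPart part a u)
      ∎)
    where
    v∉Vₐ : part v ≢ a
    v∉Vₐ pv≡a = a≢b (trans (sym pv≡a) (toWitness v∈Vb))

δ₁≤-σ⁻ : ∀ {r n j c} → 2 ≤ r → 0 < n → sumFin j ≡ 3 → (∀ i → 1 ≤ j i) →
         InFamily r j (ℤ.- + 1) n c → δ₁ c ≤ (r + 1) * n
δ₁≤-σ⁻ {r@(suc r-1)} {n} {j} {c} 2≤r@(s≤s 1≤r-1) 0<n Σj≡3 1≤j (part , sizes , types) = begin
  δ₁ c                         ≤⟨ δ₁≤degree c v ⟩
  degree c v                   ≤⟨ degree≤count c v neighbour∉Vb ⟩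
  count (not ∘ inPart part b)  ≡⟨ +-cancelˡ-≡ (r-1 * n) _ _ |Vb|+|rest| ⟩
  (r + 1) * n                  ∎
  where
  open ≤-Reasoning
  b = proj₁ (sumFin≡3⇒∃≡1 j 2≤r Σj≡3 1≤j)
  jb≡1 = proj₂ (sumFin≡3⇒∃≡1 j 2≤r Σj≡3 1≤j)
  |Vb| : count (inPart part b) ≡ r-1 * n
  |Vb| = +-injective-* r-1 n
    (subst (λ x → + count (inPart part b) ≡ (+ x ℤ.+ ℤ.-[1+ 0 ]) ℤ.* + n)
           (trans (cong (r *_) jb≡1) (*-identityʳ r)) (sizes b))
  |Vb|+|rest| : r-1 * n + count (not ∘ inPart part b) ≡ r-1 * n + (r + 1) * n
  |Vb|+|rest| = begin-equality
    r-1 * n + count (not ∘ inPart part b)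
      ≡⟨ cong (_+ count (not ∘ inPart part b)) |Vb| ⟨
    count (inPart part b) + count (not ∘ inPart part b)
      ≡⟨ count-complement (inPart part b) ⟩
    2 * r * n
      ≡⟨ solve 2 (λ r-1 n → con 2 :* (con 1 :+ r-1) :* n
                          := r-1 :* n :+ (con 1 :+ r-1 :+ con 1) :* n) refl r-1 n ⟩
    r-1 * n + (r + 1) * n
      ∎
  0<|Vb| : 0 < count (inPart part b)
  0<|Vb| = subst (0 <_) (sym |Vb|) (*-mono-≤ 1≤r-1 0<n)
  v = proj₁ (count-witness (inPart part b) 0<|Vb|)
  v∈Vb = proj₂ (count-witness (inPart part b) 0<|Vb|)
  neighbour∉Vb : ∀ u i → c v u ≡ just i → T (not (inPart part b u))
  neighbour∉Vb u i cvu≡i = 𝟙-zero (+-cancelˡ-≤ 1 _ _ (begin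
    1 + 𝟙 (inPart part b u)                    ≡⟨ cong (_+ 𝟙 (inPart part b u)) (𝟙-true v∈Vb) ⟨
    𝟙 (inPart part b v) + 𝟙 (inPart part b u)  ≤⟨ type⁻⇒≤ ⌊ b ≟ i ⌋ (types v u i cvu≡i b) ⟩
    j b                                        ≡⟨ jb≡1 ⟩
    1 + 0                                      ∎))

δ₁≤ : ∀ {r n c} → 2 ≤ r → InUnion r n c → δ₁ c ≤ (r + 1) * n
δ₁≤ {r} {zero} {c} _ _ = ≤-trans (≤-reflexive (δ₁-empty c (*-zeroʳ (2 * r)))) z≤n
δ₁≤ {n = suc _} 2≤r (j , _ , (inj₁ refl , Σj , _) , H) = δ₁≤-σ⁺ 2≤r (s≤s z≤n) (Σ⁺ Σj) H
  where
  Σ⁺ : ∀ {s} → + 1 ℤ.+ + s ≡ + 2 → s ≡ 1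
  Σ⁺ = suc-injective ∘ ℤ.+-injective
δ₁≤ {n = suc _} 2≤r (j , _ , (inj₂ refl , Σj , nonneg) , H) =
  δ₁≤-σ⁻ 2≤r (s≤s z≤n) (Σ⁻ Σj) (nonneg⇒1≤ ∘ nonneg) H
  where
  Σ⁻ : ∀ {s} → ℤ.-[1+ 0 ] ℤ.+ + s ≡ + 2 → s ≡ 3
  Σ⁻ {suc s} s≡2 = cong suc (ℤ.+-injective s≡2)
  nonneg⇒1≤ : ∀ {m} → + 0 ℤ.≤ + m ℤ.+ ℤ.-[1+ 0 ] → 1 ≤ m
  nonneg⇒1≤ {suc m} _ = s≤s z≤n

-- The vertices form 2r blocks of n (numbered by quotient n); blocks 0 … r-1
-- make up the parts 0 … r-1 and the remaining r blocks are added to part 0.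
shape : ∀ {k} → Fin (2 * suc k) → Fin (suc k)
shape {k} ρ = [ id , const zero ]′ (splitAt (suc k) ρ)

starPart : ∀ {k} n → Fin (2 * suc k * n) → Fin (suc k)
starPart n = shape ∘ quotient n

starColour : ∀ {k} → Fin (suc k) → Fin (suc k) → Maybe (Fin (suc k))
starColour zero    b       = just b
starColour (suc a) zero    = just (suc a)
starColour (suc _) (suc _) = nothing

star : ∀ {k} n → Colouring (suc k) (2 * suc k * n)
star n u v = if ⌊ u ≟ v ⌋ then nothing else starColour (starPart n u) (starPart n v)

star-isColoured2Graph : ∀ {k} n → IsColoured2Graph (star {k} n)
star-isColoured2Graph n = symmetric , loopless
  where
  starColour-comm : ∀ {k} (a b : Fin (suc k)) → starColour a b ≡ starColour b a
  starColour-comm zero    zero    = refl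
  starColour-comm zero    (suc b) = refl
  starColour-comm (suc a) zero    = refl
  starColour-comm (suc a) (suc b) = refl
  symmetric : ∀ u v → star n u v ≡ star n v u
  symmetric u v =
    cong₂ (if_then nothing else_) (≟-sym u v) (starColour-comm (starPart n u) (starPart n v))
  loopless : ∀ v → star n v v ≡ nothing
  loopless v = cong (if_then nothing else starColour (starPart n v) (starPart n v))
                    (cong ⌊_⌋ (≡-≟-identity _≟_ refl))

e₁≡𝟙 : ∀ {k} (i : Fin (suc k)) → e₁ i ≡ 𝟙 ⌊ zero ≟ i ⌋
e₁≡𝟙 zero    = refl
e₁≡𝟙 (suc i) = refl

count-shape : ∀ {k} (i : Fin (suc k)) → count (λ ρ → ⌊ shape ρ ≟ i ⌋) ≡ suc k * e₁ i + 1
count-shape {k} i = begin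
  count (λ ρ → ⌊ shape ρ ≟ i ⌋)
    ≡⟨ count-↑ (suc k) {suc k + 0} (λ ρ → ⌊ shape ρ ≟ i ⌋) ⟩
  count {suc k} (λ ρ → ⌊ shape (ρ ↑ˡ suc k + 0) ≟ i ⌋) + count (λ ρ → ⌊ shape (suc k ↑ʳ ρ) ≟ i ⌋)
    ≡⟨ cong₂ _+_ (count-cong (λ ρ → cong (part≟i) (splitAt-↑ˡ (suc k) ρ (suc k + 0))))
                 (count-cong (λ ρ → cong (part≟i) (splitAt-↑ʳ (suc k) (suc k + 0) ρ))) ⟩
  count {suc k} (λ ρ → ⌊ ρ ≟ i ⌋) + count {suc k + 0} (const ⌊ zero ≟ i ⌋)
    ≡⟨ cong₂ _+_ (count-≟ i) (count-const (suc k + 0) _) ⟩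
  1 + (suc k + 0) * 𝟙 ⌊ zero ≟ i ⌋
    ≡⟨ +-comm 1 _ ⟩
  (suc k + 0) * 𝟙 ⌊ zero ≟ i ⌋ + 1
    ≡⟨ cong₂ (λ m e → m * e + 1) (+-identityʳ (suc k)) (sym (e₁≡𝟙 i)) ⟩
  suc k * e₁ i + 1
    ∎
  where
  open ≡-Reasoning
  part≟i : Fin (suc k) ⊎ Fin (suc k + 0) → Bool
  part≟i s = ⌊ [ id , const zero ]′ s ≟ i ⌋

starPart-size : ∀ {k} n (i : Fin (suc k)) →
                count (inPart (starPart n) i) ≡ (suc k * e₁ i + 1) * n
starPart-size {k} n i =
  trans (count-∘quotient (2 * suc k) n (λ ρ → ⌊ shape ρ ≟ i ⌋)) (cong (_* n) (count-shape i))

starColour-type : ∀ {k} (a b i m : Fin (suc k)) → starColour a b ≡ just i →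
                  𝟙 ⌊ a ≟ m ⌋ + 𝟙 ⌊ b ≟ m ⌋ ≡ e₁ m + 𝟙 ⌊ m ≟ i ⌋
starColour-type zero    b    .b       m refl = cong₂ _+_ (sym (e₁≡𝟙 m)) (cong 𝟙 (≟-sym b m))
starColour-type (suc a) zero .(suc a) m refl =
  trans (+-comm (𝟙 ⌊ suc a ≟ m ⌋) _) (starColour-type zero (suc a) (suc a) m refl)

star∈family : ∀ {k} n → InFamily (suc k) e₁ (+ 1) n (star n)
star∈family {k} n = starPart n , size , type
  where
  size : ∀ i → + count (inPart (starPart n) i) ≡ (+ (suc k * e₁ i) ℤ.+ + 1) ℤ.* + n
  size i = trans (cong +_ (starPart-size n i)) (ℤ.pos-* (suc k * e₁ i + 1) n)
  else-branch : ∀ t {x : Maybe (Fin (suc k))} {i} → (if t then nothing else x) ≡ just i → x ≡ just i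
  else-branch false x≡i = x≡i
  +𝟙 : ∀ y t → + (y + 𝟙 t) ≡ + y ℤ.+ (if t then + 1 else + 0)
  +𝟙 y true  = refl
  +𝟙 y false = refl
  type : ∀ u v i → star n u v ≡ just i → ∀ m →
         + (𝟙 (inPart (starPart n) m u) + 𝟙 (inPart (starPart n) m v))
           ≡ + e₁ m ℤ.+ (if ⌊ m ≟ i ⌋ then + 1 else + 0)
  type u v i uv≡i m = trans
    (cong +_ (starColour-type (starPart n u) (starPart n v) i m (else-branch ⌊ u ≟ v ⌋ uv≡i)))
    (+𝟙 (e₁ m) ⌊ m ≟ i ⌋)

star-adjacent : ∀ {k} n {u v} → u ≢ v → starPart {k} n u ≡ zero ⊎ starPart n v ≡ zero →
                T (is-just (star n u v))
star-adjacent {k} n {u} {v} u≢v meets-V₀ =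
  else-just ⌊ u ≟ v ⌋ (fromWitnessFalse u≢v) (starColour-just meets-V₀)
  where
  else-just : ∀ t {x : Maybe (Fin (suc k))} → T (not t) → T (is-just x) →
              T (is-just (if t then nothing else x))
  else-just false _ x-just = x-just
  starColour-just : ∀ {a b : Fin (suc k)} → a ≡ zero ⊎ b ≡ zero → T (is-just (starColour a b))
  starColour-just {zero}          _         = _
  starColour-just {suc a} {zero}  _         = _
  starColour-just {suc a} {suc b} (inj₁ ())
  starColour-just {suc a} {suc b} (inj₂ ())

1+[r+1]n≤2rn : ∀ {k n} → 1 ≤ k → 0 < n → 1 + (suc k + 1) * n ≤ 2 * suc k * n
1+[r+1]n≤2rn {k} {n} 1≤k 0<n = begin
  1 + (suc k + 1) * n      ≤⟨ +-monoˡ-≤ ((suc k + 1) * n) (*-mono-≤ 1≤k 0<n) ⟩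
  k * n + (suc k + 1) * n  ≡⟨ solve 2 (λ k n → k :* n :+ (con 1 :+ k :+ con 1) :* n
                                             := con 2 :* (con 1 :+ k) :* n) refl k n ⟩
  2 * suc k * n            ∎
  where open ≤-Reasoning

star-degree : ∀ {k} → 1 ≤ k → ∀ {n} → 0 < n → ∀ v → (suc k + 1) * n ≤ degree (star n) v
star-degree {k} 1≤k {n} 0<n v with starPart n v in pv≡
... | zero = begin
  (suc k + 1) * n
    ≤⟨ +-cancelˡ-≤ 1 _ _ (≤-trans (1+[r+1]n≤2rn 1≤k 0<n) (≤-reflexive N≡1+rest)) ⟩
  count (λ u → not ⌊ v ≟ u ⌋)
    ≤⟨ count-mono u≢v⇒adjacent ⟩
  degree (star n) v
    ∎
  where
  open ≤-Reasoning
  u≢v⇒adjacent : ∀ u → T (not ⌊ v ≟ u ⌋) → T (is-just (star n v u))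
  u≢v⇒adjacent u v≢u = star-adjacent n (toWitnessFalse {a? = v ≟ u} v≢u) (inj₁ pv≡)
  N≡1+rest : 2 * suc k * n ≡ 1 + count (λ u → not ⌊ v ≟ u ⌋)
  N≡1+rest = begin-equality
    2 * suc k * n
      ≡⟨ count-complement (λ u → ⌊ v ≟ u ⌋) ⟨
    count (λ u → ⌊ v ≟ u ⌋) + count (λ u → not ⌊ v ≟ u ⌋)
      ≡⟨ cong (_+ count (λ u → not ⌊ v ≟ u ⌋)) (trans (count-cong (≟-sym v)) (count-≟ v)) ⟩
    1 + count (λ u → not ⌊ v ≟ u ⌋)
      ∎
... | suc a = begin
  (suc k + 1) * n                    ≡⟨ cong (λ x → (x + 1) * n) (*-identityʳ (suc k)) ⟨
  (suc k * e₁ {suc k} zero + 1) * n  ≡⟨ starPart-size {k} n zero ⟨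
  count (inPart (starPart n) zero)   ≤⟨ count-mono u∈V₀⇒adjacent ⟩
  degree (star n) v                  ∎
  where
  open ≤-Reasoning
  u∈V₀⇒adjacent : ∀ u → T (inPart (starPart n) zero u) → T (is-just (star n v u))
  u∈V₀⇒adjacent u u∈V₀ = star-adjacent n v≢u (inj₂ pu≡0)
    where
    pu≡0 : starPart n u ≡ zero
    pu≡0 = toWitness {a? = starPart n u ≟ zero} u∈V₀
    v≢u : v ≢ u
    v≢u refl = case trans (sym pv≡) pu≡0 of λ ()

e₁-valid : ∀ {k} → Valid2 (suc k) e₁ (+ 1)
e₁-valid {k} = inj₁ refl , cong (λ s → + 1 ℤ.+ + s) Σe₁≡1 , λ _ → ℤ.+≤+ z≤n
  where
  Σe₁≡1 : sumFin {suc k} e₁ ≡ 1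
  Σe₁≡1 = trans (sumFin-suc {k} e₁) (cong suc (trans (sumFin-const k 0) (*-zeroʳ k)))

star∈union : ∀ {k} n → InUnion (suc k) n (star n)
star∈union n = e₁ , + 1 , e₁-valid , star∈family n

δ₁-star : ∀ {k} → 1 ≤ k → ∀ n → δ₁ (star {k} n) ≡ (suc k + 1) * n
δ₁-star {k} 1≤k n = ≤-antisym (δ₁≤ (s≤s 1≤k) (star∈union n)) (lower n)
  where
  lower : ∀ n → (suc k + 1) * n ≤ δ₁ (star n)
  lower zero    = ≤-trans (≤-reflexive (*-zeroʳ (suc k + 1))) z≤n
  lower (suc n) = ≤δ₁ (star (suc n)) (≤-trans (s≤s z≤n) (1+[r+1]n≤2rn 1≤k (s≤s z≤n)))
                      (star-degree 1≤k (s≤s z≤n))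

toℚᵘ-divℕ : ∀ a b → ℚ.toℚᵘ (divℕ a (suc b)) ℚᵘ.≃ mkℚᵘ (+ a) b
toℚᵘ-divℕ a b = ℚ.toℚᵘ-fromℚᵘ (mkℚᵘ (+ a) b)

divℕ-≤ : ∀ {a b c d} → a * suc d ≤ c * suc b → divℕ a (suc b) ℚ.≤ divℕ c (suc d)
divℕ-≤ {a} {b} {c} {d} ad≤cb = ℚ.toℚᵘ-cancel-≤
  (ℚᵘ.≤-respˡ-≃ (ℚᵘ.≃-sym (toℚᵘ-divℕ a b)) (ℚᵘ.≤-respʳ-≃ (ℚᵘ.≃-sym (toℚᵘ-divℕ c d))
    (ℚᵘ.*≤* (subst₂ ℤ._≤_ (ℤ.pos-* a (suc d)) (ℤ.pos-* c (suc b)) (ℤ.+≤+ ad≤cb)))))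

divℕ-monoˡ-≤ : ∀ {a c} b → a ≤ c → divℕ a b ℚ.≤ divℕ c b
divℕ-monoˡ-≤         zero    _   = ℚ.≤-refl
divℕ-monoˡ-≤ {a} {c} (suc b) a≤c = divℕ-≤ {a} {b} {c} {b} (*-monoˡ-≤ (suc b) a≤c)

divℕ-≤-+ : ∀ {a b c d e f} → a * (suc d * suc f) ≤ (c * suc f + e * suc d) * suc b →
           divℕ a (suc b) ℚ.≤ divℕ c (suc d) ℚ.+ divℕ e (suc f)
divℕ-≤-+ {a} {b} {c} {d} {e} {f} ineq = ℚ.toℚᵘ-cancel-≤
  (ℚᵘ.≤-respˡ-≃ (ℚᵘ.≃-sym (toℚᵘ-divℕ a b))
    (ℚᵘ.≤-respʳ-≃ (ℚᵘ.≃-sym (ℚᵘ.≃-trans (ℚ.toℚᵘ-homo-+ (divℕ c (suc d)) (divℕ e (suc f)))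
                                         (ℚᵘ.+-cong (toℚᵘ-divℕ c d) (toℚᵘ-divℕ e f))))
      (ℚᵘ.*≤* (subst₂ ℤ._≤_ (ℤ.pos-* a _) rhs (ℤ.+≤+ ineq)))))
  where
  rhs : + ((c * suc f + e * suc d) * suc b) ≡ (+ c ℤ.* + suc f ℤ.+ + e ℤ.* + suc d) ℤ.* + suc b
  rhs = trans (ℤ.pos-* (c * suc f + e * suc d) (suc b))
    (cong (ℤ._* + suc b) (trans (ℤ.pos-+ (c * suc f) _) (cong₂ ℤ._+_ (ℤ.pos-* c _) (ℤ.pos-* e _))))

∣-∣≤ : ∀ {p q r} → q ℚ.≤ p → p ℚ.≤ r ℚ.+ q → ℚ.∣ p ℚ.- q ∣ ℚ.≤ r
∣-∣≤ {p} {q} {r} q≤p p≤r+q = begin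
  ℚ.∣ p ℚ.- q ∣    ≡⟨ ℚ.0≤p⇒∣p∣≡p 0≤p-q ⟩
  p ℚ.- q          ≤⟨ ℚ.+-monoˡ-≤ (ℚ.- q) p≤r+q ⟩
  r ℚ.+ q ℚ.- q    ≡⟨ ℚ.+-assoc r q (ℚ.- q) ⟩
  r ℚ.+ (q ℚ.- q)  ≡⟨ cong (r ℚ.+_) (ℚ.+-inverseʳ q) ⟩
  r ℚ.+ ℚ.0ℚ       ≡⟨ ℚ.+-identityʳ r ⟩
  r                ∎
  where
  open ℚ.≤-Reasoning
  0≤p-q : ℚ.0ℚ ℚ.≤ p ℚ.- q
  0≤p-q = begin
    ℚ.0ℚ     ≡⟨ ℚ.+-inverseʳ q ⟨
    q ℚ.- q  ≤⟨ ℚ.+-monoˡ-≤ (ℚ.- q) q≤p ⟩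
    p ℚ.- q  ∎

error-bound : ∀ {A D m n E} p → A ≤ D → m ≤ E → suc E ≡ D * n →
              A * n * (m * D) ≤ (suc p * D + A * m) * E
error-bound {A} {D} {m} {n} {E} p A≤D m≤E 1+E≡Dn = begin
  A * n * (m * D)            ≡⟨ solve 4 (λ A D m n → A :* n :* (m :* D) := A :* m :* (D :* n))
                                        refl A D m n ⟩
  A * m * (D * n)            ≡⟨ cong (λ x → A * m * x) 1+E≡Dn ⟨
  A * m * suc E              ≡⟨ *-suc (A * m) E ⟩
  A * m + A * m * E          ≤⟨ +-monoˡ-≤ (A * m * E) (*-mono-≤ A≤D m≤E) ⟩
  D * E + A * m * E          ≤⟨ +-monoˡ-≤ (A * m * E) (*-monoˡ-≤ E (m≤m+n D (p * D))) ⟩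
  suc p * D * E + A * m * E  ≡⟨ *-distribʳ-+ E (suc p * D) (A * m) ⟨
  (suc p * D + A * m) * E    ∎
  where open ≤-Reasoning

-- The error A / (D (Dn - 1)) is below 1/n, so N₀ = q + 1 works for ε = (p + 1)/(q + 1).
divℕ-converges : ∀ A D → A ≤ D → 2 ≤ D →
                 ConvergesTo (λ n → divℕ (A * n) (D * n ∸ 1)) (divℕ A D)
divℕ-converges A D@(suc d) A≤D 2≤D ε@(ℚ.mkℚ ℤ.+[1+ p ] q _) _ = suc q , close
  where
  close : ∀ n → suc q ≤ n → ℚ.∣ divℕ (A * n) (D * n ∸ 1) ℚ.- divℕ A D ∣ ℚ.≤ ε
  close n 1+q≤n with m≤n⇒∃[o]m+o≡n (*-mono-≤ 2≤D (≤-trans (s≤s z≤n) 1+q≤n))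
  ... | B , 2+B≡Dn = subst (λ x → ℚ.∣ divℕ (A * n) x ℚ.- divℕ A D ∣ ℚ.≤ ε)
                           (cong (_∸ 1) 2+B≡Dn) (∣-∣≤ lower upper)
    where
    n≤1+B : n ≤ suc B
    n≤1+B = ≤-pred (begin
      suc n  ≤⟨ +-monoˡ-≤ n (≤-trans (s≤s z≤n) 1+q≤n) ⟩
      n + n  ≡⟨ cong (_+_ n) (+-identityʳ n) ⟨
      2 * n  ≤⟨ *-monoˡ-≤ n 2≤D ⟩
      D * n  ≡⟨ 2+B≡Dn ⟨
      2 + B  ∎)
      where open ≤-Reasoning
    lower : divℕ A D ℚ.≤ divℕ (A * n) (suc B)
    lower = divℕ-≤ {A} {d} {A * n} {B} (begin
      A * suc B    ≤⟨ *-monoʳ-≤ A (n≤1+n (suc B)) ⟩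
      A * (2 + B)  ≡⟨ cong (A *_) 2+B≡Dn ⟩
      A * (D * n)  ≡⟨ solve 3 (λ A D n → A :* (D :* n) := A :* n :* D) refl A D n ⟩
      A * n * D    ∎)
      where open ≤-Reasoning
    upper : divℕ (A * n) (suc B) ℚ.≤ ε ℚ.+ divℕ A D
    upper = subst (λ x → divℕ (A * n) (suc B) ℚ.≤ x ℚ.+ divℕ A D) (ℚ.↥p/↧p≡p ε)
      (divℕ-≤-+ {A * n} {B} {suc p} {q} {A} {d} (error-bound p A≤D (≤-trans 1+q≤n n≤1+B) 2+B≡Dn))

convergesTo-≗ : ∀ {a b L} → (∀ n → a n ≡ b n) → ConvergesTo a L → ConvergesTo b L
convergesTo-≗ {L = L} a≗b a→L ε ε>0 =
  let N₀ , close = a→L ε ε>0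
  in  N₀ , λ n N₀≤n → subst (λ x → ℚ.∣ x ℚ.- L ∣ ℚ.≤ ε) (a≗b n) (close n N₀≤n)

limMaxRatio-star : ∀ {k} → 1 ≤ k → (P : (n : ℕ) → Colouring (suc k) (2 * suc k * n) → Set) →
                   (∀ {n c} → P n c → InUnion (suc k) n c) → (∀ n → P n (star n)) →
                   LimMaxRatio (suc k) P (divℕ (suc k + 1) (2 * suc k))
limMaxRatio-star {k} 1≤k P P⊆union star∈P = (λ n → ratio (star n)) , isMax , converges
  where
  isMax : ∀ n → IsMaxRatio (suc k) n (P n) (ratio (star n))
  isMax n = (λ c _ Pc → divℕ-monoˡ-≤ ((2 * suc k * n ∸ 1) C 1) (δ₁≤δ₁-star c Pc))
          , star n , star-isColoured2Graph n , star∈P n , refl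
    where
    δ₁≤δ₁-star : ∀ c → P n c → δ₁ c ≤ δ₁ (star n)
    δ₁≤δ₁-star c Pc = ≤-trans (δ₁≤ (s≤s 1≤k) (P⊆union Pc)) (≤-reflexive (sym (δ₁-star 1≤k n)))
  ratio-star : ∀ n → divℕ ((suc k + 1) * n) (2 * suc k * n ∸ 1) ≡ ratio (star n)
  ratio-star n = sym (cong₂ divℕ (δ₁-star 1≤k n) (nC1≡n (2 * suc k * n ∸ 1)))
  converges : ConvergesTo (λ n → ratio (star n)) (divℕ (suc k + 1) (2 * suc k))
  converges = convergesTo-≗ ratio-star
    (divℕ-converges (suc k + 1) (2 * suc k) (+-monoʳ-≤ (suc k) (s≤s z≤n)) (*-monoʳ-≤ 2 (s≤s z≤n)))

lemma4p3 : (r : ℕ) → 2 ≤ r →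
    LimMaxRatio r (InUnion r) (divℕ (r + 1) (2 * r))
      × LimMaxRatio r (InFamily r e₁ (+ 1)) (divℕ (r + 1) (2 * r))
lemma4p3 (suc k) (s≤s 1≤k) =
    limMaxRatio-star 1≤k (InUnion (suc k)) id star∈union
  , limMaxRatio-star 1≤k (InFamily (suc k) e₁ (+ 1)) (λ H → e₁ , + 1 , e₁-valid , H) star∈family
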